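{- Let $q\neq1$ be real, $D_q$ the $q$-derivative in $x$ ($D_qp(x)=\frac{p(x)-p(qx)}{(1-q)x}$, $s$ constant), and $A=x+(q-1)sD_q$. Define $Luc_n(x,s,q)=L_n(A,s)\,1$, where $L_0(x,s)=2$ and $L_n(x,s)=\sum_{j=0}^{\lfloor n/2\rfloor}\binom{n-j}{j}\frac{n}{n-j}s^jx^{n-2j}$ for $n>0$. Then for all $n\ge1$, $$Luc_n(x,s,q)=\sum_{j=0}^{\lfloor n/2\rfloor}q^{\binom j2}\begin{bmatrix} n-j\\ j\end{bmatrix}_q\frac{[n]_q}{[n-j]_q}s^jx^{n-2j}.$$
   Context: $L_n(A,s)1$ means $\sum_j c_j s^j A^{n-2j}1$ where $L_n(x,s)=\sum_j c_js^jx^{n-2j}$. $[n]_q=\frac{1-q^n}{1-q}$, $\begin{bmatrix} n\\ k\end{bmatrix}_q=\frac{[n]_q!}{[k]_q![n-k]_q!}$. -}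

module Defs where

open import Level using (_⊔_) renaming (suc to lsuc)
open import Data.Nat.Base using (ℕ; zero; suc; _∸_; ⌊_/2⌋; NonZero)
  renaming (_*_ to _*ℕ_; _/_ to _/ℕ_)
open import Data.Nat.Combinatorics using (_C_)
open import Data.Nat.Properties using (_≟_)
open import Data.Bool.Base using (if_then_else_)
open import Relation.Nullary using (¬_; does)
open import Algebra.Bundles using (CommutativeRing)

record Field c ℓ : Set (lsuc (c ⊔ ℓ)) where
  field
    commutativeRing : CommutativeRing c ℓ
  open CommutativeRing commutativeRing public
  field
    _⁻¹       : Carrier → Carrier
    ⁻¹-inverse : ∀ x → ¬ (x ≈ 0#) → x * (x ⁻¹) ≈ 1#
    0≉1       : ¬ (0# ≈ 1#)

-- The Lucas coefficient  binom(n-j, j) * n/(n-j)  (an integer for j < n),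
-- computed by exact natural-number division.
lucasCoef : ℕ → ℕ → ℕ
lucasCoef n j with n ∸ j
... | zero  = 0
... | suc d = (((n ∸ j) C j) *ℕ n) /ℕ (suc d)

module FieldDefs {c ℓ} (F : Field c ℓ) where
  open Field F

  infixl 7 _/_
  _/_ : Carrier → Carrier → Carrier
  x / y = x * (y ⁻¹)

  pow : Carrier → ℕ → Carrier
  pow x zero    = 1#
  pow x (suc n) = x * pow x n

  fromℕ : ℕ → Carrier
  fromℕ zero    = 0#
  fromℕ (suc n) = 1# + fromℕ n

  sumUpTo : (ℕ → Carrier) → ℕ → Carrier
  sumUpTo f zero    = f 0
  sumUpTo f (suc N) = sumUpTo f N + f (suc N)

  qint : Carrier → ℕ → Carrier
  qint q n = (1# - pow q n) / (1# - q)

  qfact : Carrier → ℕ → Carrier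
  qfact q zero    = 1#
  qfact q (suc n) = qfact q n * qint q (suc n)

  qbinom : Carrier → ℕ → ℕ → Carrier
  qbinom q n k = qfact q n / (qfact q k * qfact q (n ∸ k))

  -- Polynomials in x, represented by their coefficient sequences:
  -- p k = coefficient of x^k.
  Poly : Set c
  Poly = ℕ → Carrier

  onePoly : Poly
  onePoly zero    = 1#
  onePoly (suc k) = 0#

  mono : ℕ → Poly
  mono m k = if does (k ≟ m) then 1# else 0#

  mulX : Poly → Poly
  mulX p zero    = 0#
  mulX p (suc k) = p k

  -- q-derivative  D_q p(x) = (p(x) - p(qx)) / ((1-q) x) :
  -- p(x) - p(qx) has coefficient (1 - q^k) p_k at x^k (zero at k = 0),
  -- so the coefficient of x^k in D_q p is (1 - q^(k+1)) p_(k+1) / (1 - q).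
  Dq : Carrier → Poly → Poly
  Dq q p k = ((1# - pow q (suc k)) * p (suc k)) / (1# - q)

  Aop : Carrier → Carrier → Poly → Poly
  Aop q s p k = mulX p k + ((q - 1#) * s) * Dq q p k

  iter : (Poly → Poly) → ℕ → Poly → Poly
  iter f zero    p = p
  iter f (suc m) p = f (iter f m p)

  Luc : Carrier → Carrier → ℕ → Poly
  Luc q s zero    k = (1# + 1#) * onePoly k
  Luc q s (suc n) k =
    sumUpTo (λ j → fromℕ (lucasCoef (suc n) j) * pow s j
                   * iter (Aop q s) (suc n ∸ (2 *ℕ j)) onePoly k)
            ⌊ suc n /2⌋

  lucRHS : Carrier → Carrier → ℕ → Poly
  lucRHS q s n k =
    sumUpTo (λ j → pow q (j C 2) * qbinom q (n ∸ j) j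
                   * (qint q n / qint q (n ∸ j)) * pow s j
                   * mono (n ∸ (2 *ℕ j)) k)
            ⌊ n /2⌋

module Submission where

-- Both Luc_n and the right-hand side R_n satisfy P_(n+2) = A P_(n+1) + s P_n for n ≥ 1, and
-- they agree for n = 1, 2.  For Luc_n this is linearity of A together with the
-- recurrence of the integer coefficients binom(n-j, j) n/(n-j), the one satisfied by the Lucas
-- polynomials.  On coefficient sequences A acts by (A p)_k = p_(k-1) - s (1 - q^(k+1)) p_(k+1),
-- so for R_n the recurrence is a three-term identity between its q-coefficients.  Since q^k ≠ 1
-- for 1 ≤ k ≤ n, every q-integer involved is invertible, and after clearing denominators that
-- identity is a polynomial identity in q, q^p and q^j.

open import Defs
open import Data.Nat.Base using (ℕ; _≤_)
open import Relation.Nullary using (¬_)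

open import Algebra.Bundles using (CommutativeRing)
open import Data.Nat.Base as ℕ using (zero; suc; _<_; z≤n; s≤s; _∸_; ⌊_/2⌋)
import Data.Nat.Properties as ℕ
open import Data.Nat.Combinatorics using (_C_)
open import Data.Integer.Base as ℤ using (ℤ; -[1+_])
import Data.Integer.Properties as ℤ
open import Data.Sign.Base as Sign using (Sign)
open import Data.Maybe.Base using (Maybe; just; nothing)
open import Data.Empty using (⊥-elim)
open import Function.Base using (_∘_)
open import Relation.Nullary using (yes; no)
open import Relation.Nullary.Decidable using (dec-true; dec-false)
open import Relation.Binary.PropositionalEquality as ≡ using (_≡_; _≢_)

-- The ring solver of the standard library takes its constants from a coefficient ring mapped
-- into the carrier; integer coefficients let the identities below mention 0#, 1# and -1#.
module IntegerCoefficientSolver {c ℓ} (R : CommutativeRing c ℓ) where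
  open import Data.Integer.Base using (+_)
  open CommutativeRing R
  open import Algebra.Properties.Ring ring using (-0#≈0#; -‿distribˡ-*; -‿distribʳ-*)
  open import Algebra.Properties.AbelianGroup +-abelianGroup using (⁻¹-∙-comm)
  open import Algebra.Properties.Group +-group using (⁻¹-involutive)
  open import Algebra.Properties.CommutativeSemigroup +-commutativeSemigroup using (interchange)
  open import Algebra.Properties.Semiring.Mult.TCOptimised semiring using (_×_; 1+×; ×-homo-+; ×1-homo-*)
  open import Algebra.Solver.Ring.AlmostCommutativeRing
  open import Relation.Binary.Reasoning.Setoid setoid

  ⟦_⟧ℤ : ℤ → Carrier
  ⟦ + n ⟧ℤ      = n × 1#
  ⟦ -[1+ n ] ⟧ℤ = - (suc n × 1#)

  private
    signed : Sign → Carrier → Carrier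
    signed Sign.+ x = x
    signed Sign.- x = - x

    signed-cong : ∀ s {x y} → x ≈ y → signed s x ≈ signed s y
    signed-cong Sign.+ x≈y = x≈y
    signed-cong Sign.- = -‿cong

    signed-* : ∀ s t x y → signed (s Sign.* t) (x * y) ≈ signed s x * signed t y
    signed-* Sign.+ Sign.+ x y = refl
    signed-* Sign.+ Sign.- x y = -‿distribʳ-* x y
    signed-* Sign.- Sign.+ x y = -‿distribˡ-* x y
    signed-* Sign.- Sign.- x y = begin
      x * y         ≈⟨ ⁻¹-involutive _ ⟨
      - - (x * y)   ≈⟨ -‿cong (-‿distribʳ-* x y) ⟩
      - (x * - y)   ≈⟨ -‿distribˡ-* x (- y) ⟩
      - x * - y     ∎

    ⟦⟧ℤ-signAbs : ∀ i → ⟦ i ⟧ℤ ≈ signed (ℤ.sign i) (ℤ.∣ i ∣ × 1#)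
    ⟦⟧ℤ-signAbs (+ n)    = refl
    ⟦⟧ℤ-signAbs -[1+ n ] = refl

    ⟦◃⟧ : ∀ s n → ⟦ s ℤ.◃ n ⟧ℤ ≈ signed s (n × 1#)
    ⟦◃⟧ Sign.+ zero    = refl
    ⟦◃⟧ Sign.- zero    = sym -0#≈0#
    ⟦◃⟧ Sign.+ (suc n) = refl
    ⟦◃⟧ Sign.- (suc n) = refl

    ⟦⊖⟧ : ∀ m n → ⟦ m ℤ.⊖ n ⟧ℤ ≈ m × 1# - n × 1#
    ⟦⊖⟧ zero    zero    = sym (-‿inverseʳ 0#)
    ⟦⊖⟧ (suc m) zero    = sym (trans (+-congˡ -0#≈0#) (+-identityʳ _))
    ⟦⊖⟧ zero    (suc n) = sym (+-identityˡ _)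
    ⟦⊖⟧ (suc m) (suc n) = begin
      ⟦ suc m ℤ.⊖ suc n ⟧ℤ              ≡⟨ ≡.cong ⟦_⟧ℤ (ℤ.[1+m]⊖[1+n]≡m⊖n m n) ⟩
      ⟦ m ℤ.⊖ n ⟧ℤ                      ≈⟨ ⟦⊖⟧ m n ⟩
      m × 1# - n × 1#                   ≈⟨ +-identityˡ _ ⟨
      0# + (m × 1# - n × 1#)            ≈⟨ +-congʳ (-‿inverseʳ 1#) ⟨
      (1# - 1#) + (m × 1# - n × 1#)     ≈⟨ interchange 1# (- 1#) (m × 1#) (- (n × 1#)) ⟩
      (1# + m × 1#) + (- 1# - n × 1#)   ≈⟨ +-cong (1+× m 1#) (trans (-‿cong (1+× n 1#)) (sym (⁻¹-∙-comm 1# (n × 1#)))) ⟨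
      suc m × 1# - suc n × 1#           ∎

    ⟦⟧ℤ-+ : ∀ i j → ⟦ i ℤ.+ j ⟧ℤ ≈ ⟦ i ⟧ℤ + ⟦ j ⟧ℤ
    ⟦⟧ℤ-+ (+ m)    (+ n)    = ×-homo-+ 1# m n
    ⟦⟧ℤ-+ (+ m)    -[1+ n ] = ⟦⊖⟧ m (suc n)
    ⟦⟧ℤ-+ -[1+ m ] (+ n)    = trans (⟦⊖⟧ n (suc m)) (+-comm _ _)
    ⟦⟧ℤ-+ -[1+ m ] -[1+ n ] = begin
      - (suc (suc (m ℕ.+ n)) × 1#)       ≡⟨ ≡.cong (λ k → - (suc k × 1#)) (≡.sym (ℕ.+-suc m n)) ⟩
      - ((suc m ℕ.+ suc n) × 1#)         ≈⟨ -‿cong (×-homo-+ 1# (suc m) (suc n)) ⟩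
      - (suc m × 1# + suc n × 1#)        ≈⟨ ⁻¹-∙-comm _ _ ⟨
      - (suc m × 1#) - (suc n × 1#)      ∎

    ⟦⟧ℤ-* : ∀ i j → ⟦ i ℤ.* j ⟧ℤ ≈ ⟦ i ⟧ℤ * ⟦ j ⟧ℤ
    ⟦⟧ℤ-* i j = begin
      ⟦ i ℤ.* j ⟧ℤ                                  ≈⟨ ⟦◃⟧ (s Sign.* t) (ℤ.∣ i ∣ ℕ.* ℤ.∣ j ∣) ⟩
      signed (s Sign.* t) ((ℤ.∣ i ∣ ℕ.* ℤ.∣ j ∣) × 1#) ≈⟨ signed-cong (s Sign.* t) (×1-homo-* ℤ.∣ i ∣ ℤ.∣ j ∣) ⟩
      signed (s Sign.* t) (ℤ.∣ i ∣ × 1# * ℤ.∣ j ∣ × 1#) ≈⟨ signed-* s t _ _ ⟩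
      signed s (ℤ.∣ i ∣ × 1#) * signed t (ℤ.∣ j ∣ × 1#) ≈⟨ *-cong (⟦⟧ℤ-signAbs i) (⟦⟧ℤ-signAbs j) ⟨
      ⟦ i ⟧ℤ * ⟦ j ⟧ℤ                               ∎
      where s = ℤ.sign i ; t = ℤ.sign j

    ⟦⟧ℤ-neg : ∀ i → ⟦ ℤ.- i ⟧ℤ ≈ - ⟦ i ⟧ℤ
    ⟦⟧ℤ-neg (+ zero)  = sym -0#≈0#
    ⟦⟧ℤ-neg (+ suc n) = refl
    ⟦⟧ℤ-neg -[1+ n ]  = sym (⁻¹-involutive _)

    ⟦⟧ℤ-homomorphism : ℤ.+-*-rawRing -Raw-AlmostCommutative⟶ fromCommutativeRing R
    ⟦⟧ℤ-homomorphism = record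
      { ⟦_⟧ = ⟦_⟧ℤ ; +-homo = ⟦⟧ℤ-+ ; *-homo = ⟦⟧ℤ-* ; -‿homo = ⟦⟧ℤ-neg
      ; 0-homo = refl ; 1-homo = refl }

    ⟦⟧ℤ-equal? : ∀ i j → Maybe (⟦ i ⟧ℤ ≈ ⟦ j ⟧ℤ)
    ⟦⟧ℤ-equal? i j with i ℤ.≟ j
    ... | yes ≡.refl = just refl
    ... | no _       = nothing

  open import Algebra.Solver.Ring ℤ.+-*-rawRing (fromCommutativeRing R) ⟦⟧ℤ-homomorphism ⟦⟧ℤ-equal? public

module Arithmetic where
  open import Data.Nat.Base
  open import Data.Nat.Properties
  open import Data.Nat.Combinatorics using (nCk+nC[k+1]≡[n+1]C[k+1]; nC1≡n)
  open import Data.Nat.Combinatorics.Specification using (k>n⇒nCk≡0)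
  open import Data.Nat.DivMod using (n/n≡1; m*n/n≡m)
  open import Data.Nat.Tactic.RingSolver using (solve-∀)
  open import Data.Product.Base using (_,_)
  open import Relation.Binary.PropositionalEquality
  open ≡-Reasoning

  pascal : ∀ n k → suc n C suc k ≡ n C k + n C suc k
  pascal n k = sym (nCk+nC[k+1]≡[n+1]C[k+1] n k)

  [1+k]*[1+n]C[1+k]≡[1+n]*nCk : ∀ n k → suc k * (suc n C suc k) ≡ suc n * (n C k)
  [1+k]*[1+n]C[1+k]≡[1+n]*nCk zero    zero    = refl
  [1+k]*[1+n]C[1+k]≡[1+n]*nCk zero    (suc k) =
    trans (cong (suc (suc k) *_) (k>n⇒nCk≡0 {1} {suc (suc k)} (s≤s (s≤s z≤n)))) (*-zeroʳ (suc (suc k)))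
  [1+k]*[1+n]C[1+k]≡[1+n]*nCk (suc n) zero    =
    trans (+-identityʳ (suc (suc n) C 1)) (trans (nC1≡n (suc (suc n))) (sym (*-identityʳ (suc (suc n)))))
  [1+k]*[1+n]C[1+k]≡[1+n]*nCk (suc n) (suc k) = begin
    suc (suc k) * (suc (suc n) C suc (suc k))                 ≡⟨ cong (suc (suc k) *_) (pascal (suc n) (suc k)) ⟩
    suc (suc k) * (suc n C suc k + suc n C suc (suc k))       ≡⟨ *-distribˡ-+ (suc (suc k)) (suc n C suc k) (suc n C suc (suc k)) ⟩
    suc n C suc k + suc k * (suc n C suc k) + suc (suc k) * (suc n C suc (suc k))
       ≡⟨ cong₂ (λ a b → suc n C suc k + a + b) ([1+k]*[1+n]C[1+k]≡[1+n]*nCk n k) ([1+k]*[1+n]C[1+k]≡[1+n]*nCk n (suc k)) ⟩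
    suc n C suc k + suc n * (n C k) + suc n * (n C suc k)     ≡⟨ +-assoc (suc n C suc k) (suc n * (n C k)) (suc n * (n C suc k)) ⟩
    suc n C suc k + (suc n * (n C k) + suc n * (n C suc k))   ≡⟨ cong (suc n C suc k +_) (*-distribˡ-+ (suc n) (n C k) (n C suc k)) ⟨
    suc n C suc k + suc n * (n C k + n C suc k)               ≡⟨ cong (λ m → suc n C suc k + suc n * m) (pascal n k) ⟨
    suc (suc n) * (suc n C suc k)                             ∎

  lucasCoef-+ : ∀ d j → lucasCoef (suc d + j) j ≡ ((suc d C j) * (suc d + j)) / suc d
  lucasCoef-+ d j rewrite m+n∸n≡m (suc d) j =
    cong (λ m → ((m C j) * (suc d + j)) / suc d) (m+n∸n≡m (suc d) j)

  lucasCoef-≤ : ∀ {n j} → n ≤ j → lucasCoef n j ≡ 0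
  lucasCoef-≤ n≤j rewrite m≤n⇒m∸n≡0 n≤j = refl

  lucasCoef-0 : ∀ n → lucasCoef (suc n) 0 ≡ 1
  lucasCoef-0 n = trans (cong (_/ suc n) (*-identityˡ (suc n))) (n/n≡1 (suc n))

  lucasCoef-pascal : ∀ d i → lucasCoef (suc d + suc i) (suc i) ≡ suc d C suc i + d C i
  lucasCoef-pascal d i = begin
    lucasCoef (suc d + suc i) (suc i)        ≡⟨ lucasCoef-+ d (suc i) ⟩
    (x * (suc d + suc i)) / suc d            ≡⟨ cong (_/ suc d) x[1+d+1+i]≡[x+y][1+d] ⟩
    ((x + d C i) * suc d) / suc d            ≡⟨ m*n/n≡m (x + d C i) (suc d) ⟩
    x + d C i                                ∎
    where
    x = suc d C suc i
    x[1+d+1+i]≡[x+y][1+d] : x * (suc d + suc i) ≡ (x + d C i) * suc d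
    x[1+d+1+i]≡[x+y][1+d] = begin
      x * (suc d + suc i)          ≡⟨ *-distribˡ-+ x (suc d) (suc i) ⟩
      x * suc d + x * suc i        ≡⟨ cong (x * suc d +_) (*-comm x (suc i)) ⟩
      x * suc d + suc i * x        ≡⟨ cong (x * suc d +_) ([1+k]*[1+n]C[1+k]≡[1+n]*nCk d i) ⟩
      x * suc d + suc d * (d C i)  ≡⟨ cong (x * suc d +_) (*-comm (suc d) (d C i)) ⟩
      x * suc d + (d C i) * suc d   ≡⟨ *-distribʳ-+ (suc d) x (d C i) ⟨
      (x + d C i) * suc d          ∎

  lucasCoef-rec : ∀ n j → j < n →
    lucasCoef (suc (suc n)) (suc j) ≡ lucasCoef (suc n) (suc j) + lucasCoef n j
  lucasCoef-rec n j j<n with m≤n⇒∃[o]m+o≡n j<n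
  ... | d , refl = begin
    lucasCoef (suc (suc (suc j + d))) (suc j)  ≡⟨ cong (λ m → lucasCoef m (suc j)) (e₁ j d) ⟩
    lucasCoef (suc (suc d) + suc j) (suc j)    ≡⟨ lucasCoef-pascal (suc d) j ⟩
    suc (suc d) C suc j + suc d C j            ≡⟨ cong (_+ suc d C j) (pascal (suc d) j) ⟩
    suc d C j + suc d C suc j + suc d C j      ≡⟨ split j ⟩
    (suc d C suc j + d C j) + lucasCoef (suc d + j) j
      ≡⟨ cong₂ _+_ (lucasCoef-pascal d j) (cong (λ m → lucasCoef m j) (e₂ j d)) ⟨
    lucasCoef (suc d + suc j) (suc j) + lucasCoef (suc j + d) j
      ≡⟨ cong (λ m → lucasCoef m (suc j) + lucasCoef (suc j + d) j) (e₃ j d) ⟩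
    lucasCoef (suc (suc j + d)) (suc j) + lucasCoef (suc j + d) j ∎
    where
    e₁ : ∀ j d → suc (suc (suc j + d)) ≡ suc (suc d) + suc j
    e₁ = solve-∀
    e₂ : ∀ j d → suc j + d ≡ suc d + j
    e₂ = solve-∀
    e₃ : ∀ j d → suc d + suc j ≡ suc (suc j + d)
    e₃ = solve-∀
    split : ∀ j → suc d C j + suc d C suc j + suc d C j
                ≡ (suc d C suc j + d C j) + lucasCoef (suc d + j) j
    split zero    = cong₂ _+_ (+-comm 1 (suc d C 1))
      (sym (trans (cong (λ m → lucasCoef m 0) (+-identityʳ (suc d))) (lucasCoef-0 d)))
    split (suc i) = begin
      suc d C suc i + suc d C suc (suc i) + suc d C suc i
        ≡⟨ cong (λ m → suc d C suc i + suc d C suc (suc i) + m) (pascal d i) ⟩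
      suc d C suc i + suc d C suc (suc i) + (d C i + d C suc i)     ≡⟨ shuffle (suc d C suc i) (suc d C suc (suc i)) (d C i) (d C suc i) ⟩
      (suc d C suc (suc i) + d C suc i) + (suc d C suc i + d C i)
        ≡⟨ cong (suc d C suc (suc i) + d C suc i +_) (lucasCoef-pascal d i) ⟨
      (suc d C suc (suc i) + d C suc i) + lucasCoef (suc d + suc i) (suc i) ∎
      where
      shuffle : ∀ a b c e → a + b + (c + e) ≡ (b + e) + (a + c)
      shuffle = solve-∀

  lucasCoef-vanish : ∀ n j → n < j + j → lucasCoef n j ≡ 0
  lucasCoef-vanish n j n<2j with n ≤? j
  ... | yes n≤j = lucasCoef-≤ n≤j
  ... | no  n≰j with m≤n⇒∃[o]m+o≡n (≰⇒> n≰j)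
  ... | d , refl = subst (λ m → lucasCoef m j ≡ 0) (trans (+-comm (suc d) j) (+-suc j d)) vanish
    where
    1+d<j : suc d < j
    1+d<j = +-cancelˡ-< j (suc d) j (subst (_< j + j) (sym (+-suc j d)) n<2j)
    vanish : lucasCoef (suc d + j) j ≡ 0
    vanish rewrite lucasCoef-+ d j | k>n⇒nCk≡0 1+d<j = refl

  m≤⌊n/2⌋⇒m+m≤n : ∀ n m → m ≤ ⌊ n /2⌋ → m + m ≤ n
  m≤⌊n/2⌋⇒m+m≤n n             zero    _         = z≤n
  m≤⌊n/2⌋⇒m+m≤n (suc (suc n)) (suc m) (s≤s m≤) =
    s≤s (subst (_≤ suc n) (sym (+-suc m m)) (s≤s (m≤⌊n/2⌋⇒m+m≤n n m m≤)))

  m+m≤n⇒m≤⌊n/2⌋ : ∀ {m n} → m + m ≤ n → m ≤ ⌊ n /2⌋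
  m+m≤n⇒m≤⌊n/2⌋ {m} m+m≤n = subst (_≤ _) (sym (n≡⌊n+n/2⌋ m)) (⌊n/2⌋-mono m+m≤n)

  ⌊n/2⌋<m⇒n<m+m : ∀ {m n} → ⌊ n /2⌋ < m → n < m + m
  ⌊n/2⌋<m⇒n<m+m ⌊n/2⌋<m = ≰⇒> (λ m+m≤n → <⇒≱ ⌊n/2⌋<m (m+m≤n⇒m≤⌊n/2⌋ m+m≤n))

  m+m≡n+n⇒m≡n : ∀ {m n} → m + m ≡ n + n → m ≡ n
  m+m≡n+n⇒m≡n {m} {n} eq = trans (n≡⌊n+n/2⌋ m) (trans (cong ⌊_/2⌋ eq) (sym (n≡⌊n+n/2⌋ n)))

  1+m+m≢n+n : ∀ m n → suc (m + m) ≢ n + n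
  1+m+m≢n+n zero    (suc zero)    ()
  1+m+m≢n+n zero    (suc (suc n)) eq = 0≢1+n (suc-injective eq)
  1+m+m≢n+n (suc m) (suc n)       eq =
    1+m+m≢n+n m n (suc-injective (trans (sym (cong suc (+-suc m m))) (trans (suc-injective eq) (+-suc n n))))

  data Gap (n k : ℕ) : Set where
    below : n < k → Gap n k
    even  : ∀ j → n ≡ k + (j + j) → Gap n k
    odd   : ∀ j → n ≡ k + suc (j + j) → Gap n k

  gap : ∀ n k → Gap n k
  gap n       zero    = gap₀ n
    where
    gap₀ : ∀ n → Gap n 0
    gap₀ zero          = even 0 refl
    gap₀ (suc zero)    = odd 0 refl
    gap₀ (suc (suc n)) with gap₀ n
    ... | even j refl = even (suc j) (cong suc (sym (+-suc j j)))
    ... | odd  j refl = odd  (suc j) (cong (suc ∘ suc) (sym (+-suc j j)))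
  gap zero    (suc k) = below z<s
  gap (suc n) (suc k) with gap n k
  ... | below n<k = below (s<s n<k)
  ... | even j eq = even j (cong suc eq)
  ... | odd  j eq = odd  j (cong suc eq)

  2+n∸2[1+j]≡n∸2j : ∀ n j → suc (suc n) ∸ 2 * suc j ≡ n ∸ 2 * j
  2+n∸2[1+j]≡n∸2j n j = cong (suc n ∸_) (+-suc j (j + 0))

  0<m≤n⇒m<n+n : ∀ {m n} → 1 ≤ m → m ≤ n → m < n + n
  0<m≤n⇒m<n+n {m} 1≤m m≤n = <-≤-trans (m<m+n m 1≤m) (+-mono-≤ m≤n m≤n)

  m<n+n⇒2+m<[1+n]+[1+n] : ∀ {m n} → m < n + n → suc (suc m) < suc n + suc n
  m<n+n⇒2+m<[1+n]+[1+n] {m} {n} m<n+n = subst (suc (suc m) <_) (cong suc (sym (+-suc n n))) (s<s (s<s m<n+n))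

  [1+n]C2≡nC2+n : ∀ n → suc n C 2 ≡ n C 2 + n
  [1+n]C2≡nC2+n n = trans (pascal n 1) (trans (cong (_+ n C 2) (nC1≡n n)) (+-comm n (n C 2)))

  k+[1+j+1+j]≡2+k+2j : ∀ k j → k + (suc j + suc j) ≡ suc (suc (k + (j + j)))
  k+[1+j+1+j]≡2+k+2j = solve-∀

  k+[1+1+j+1+j]≡2+k+1+2j : ∀ k j → k + suc (suc j + suc j) ≡ suc (suc (k + suc (j + j)))
  k+[1+1+j+1+j]≡2+k+1+2j = solve-∀

open Arithmetic

module FieldProperties {c ℓ} (F : Field c ℓ) where
  open Field F
  open FieldDefs F
  open import Relation.Binary.Reasoning.Setoid setoid

  1≉0 : ¬ (1# ≈ 0#)
  1≉0 1≈0 = 0≉1 (sym 1≈0)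

  *-cancelʳ : ∀ {x y z} → ¬ (z ≈ 0#) → x * z ≈ y * z → x ≈ y
  *-cancelʳ {x} {y} {z} z≉0 xz≈yz = begin
    x                ≈⟨ *-identityʳ x ⟨
    x * 1#           ≈⟨ *-congˡ (⁻¹-inverse z z≉0) ⟨
    x * (z * z ⁻¹)   ≈⟨ *-assoc x z _ ⟨
    x * z * z ⁻¹     ≈⟨ *-congʳ xz≈yz ⟩
    y * z * z ⁻¹     ≈⟨ *-assoc y z _ ⟩
    y * (z * z ⁻¹)   ≈⟨ *-congˡ (⁻¹-inverse z z≉0) ⟩
    y * 1#           ≈⟨ *-identityʳ y ⟩
    y                ∎

  *-nonzero : ∀ {x y} → ¬ (x ≈ 0#) → ¬ (y ≈ 0#) → ¬ (x * y ≈ 0#)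
  *-nonzero {x} {y} x≉0 y≉0 xy≈0 = y≉0 (*-cancelʳ x≉0 (begin
    y * x   ≈⟨ *-comm y x ⟩
    x * y   ≈⟨ xy≈0 ⟩
    0#      ≈⟨ zeroˡ x ⟨
    0# * x  ∎))

  pow-+ : ∀ x m n → pow x (m ℕ.+ n) ≈ pow x m * pow x n
  pow-+ x zero    n = sym (*-identityˡ _)
  pow-+ x (suc m) n = trans (*-congˡ (pow-+ x m n)) (sym (*-assoc _ _ _))

  sumUpTo-cong : ∀ {f g} N → (∀ j → j ≤ N → f j ≈ g j) → sumUpTo f N ≈ sumUpTo g N
  sumUpTo-cong zero    f≈g = f≈g 0 z≤n
  sumUpTo-cong (suc N) f≈g = +-cong (sumUpTo-cong N (λ j j≤N → f≈g j (ℕ.m≤n⇒m≤1+n j≤N))) (f≈g (suc N) ℕ.≤-refl)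

  sumUpTo-zero : ∀ {f} N → (∀ j → j ≤ N → f j ≈ 0#) → sumUpTo f N ≈ 0#
  sumUpTo-zero N f≈0 = trans (sumUpTo-cong N f≈0) (go N)
    where
    go : ∀ N → sumUpTo (λ _ → 0#) N ≈ 0#
    go zero    = refl
    go (suc N) = trans (+-identityʳ _) (go N)

  sumUpTo-+ : ∀ f g N → sumUpTo (λ j → f j + g j) N ≈ sumUpTo f N + sumUpTo g N
  sumUpTo-+ f g zero    = refl
  sumUpTo-+ f g (suc N) = trans (+-congʳ (sumUpTo-+ f g N)) (interchange _ _ _ _)
    where open import Algebra.Properties.CommutativeSemigroup +-commutativeSemigroup using (interchange)

  sumUpTo-*ˡ : ∀ x f N → sumUpTo (λ j → x * f j) N ≈ x * sumUpTo f N
  sumUpTo-*ˡ x f zero    = refl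
  sumUpTo-*ˡ x f (suc N) = trans (+-congʳ (sumUpTo-*ˡ x f N)) (sym (distribˡ x _ _))

  sumUpTo-unfoldˡ : ∀ f N → sumUpTo f (suc N) ≈ f 0 + sumUpTo (λ j → f (suc j)) N
  sumUpTo-unfoldˡ f zero    = refl
  sumUpTo-unfoldˡ f (suc N) = trans (+-congʳ (sumUpTo-unfoldˡ f N)) (+-assoc _ _ _)

  sumUpTo-extend : ∀ f {M N} → M ≤ N → (∀ j → M < j → f j ≈ 0#) → sumUpTo f N ≈ sumUpTo f M
  sumUpTo-extend f {M} {zero}  z≤n f≈0 = refl
  sumUpTo-extend f {M} {suc N} M≤1+N f≈0 with M ℕ.≟ suc N
  ... | yes ≡.refl = refl
  ... | no  M≢1+N  = trans (+-cong (sumUpTo-extend f (ℕ.≤-pred M<1+N) f≈0) (f≈0 (suc N) M<1+N)) (+-identityʳ _)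
    where M<1+N = ℕ.≤∧≢⇒< M≤1+N M≢1+N

  sumUpTo-single : ∀ {f} N J → J ≤ N → (∀ j → j ≤ N → j ≢ J → f j ≈ 0#) → sumUpTo f N ≈ f J
  sumUpTo-single zero    zero z≤n f≈0 = refl
  sumUpTo-single (suc N) J J≤1+N f≈0 with J ℕ.≟ suc N
  ... | yes ≡.refl = trans (+-congʳ (sumUpTo-zero N (λ j j≤N → f≈0 j (ℕ.m≤n⇒m≤1+n j≤N) (ℕ.<⇒≢ (s≤s j≤N))))) (+-identityˡ _)
  ... | no  J≢1+N  = trans (+-cong (sumUpTo-single N J (ℕ.≤-pred (ℕ.≤∧≢⇒< J≤1+N J≢1+N)) (λ j j≤N → f≈0 j (ℕ.m≤n⇒m≤1+n j≤N)))
                                   (f≈0 (suc N) ℕ.≤-refl (J≢1+N ∘ ≡.sym)))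
                           (+-identityʳ _)

  fromℕ-+ : ∀ m n → fromℕ (m ℕ.+ n) ≈ fromℕ m + fromℕ n
  fromℕ-+ zero    n = sym (+-identityˡ _)
  fromℕ-+ (suc m) n = trans (+-congˡ (fromℕ-+ m n)) (sym (+-assoc _ _ _))

  ≈0⇒x+a*y+b*z≈0 : ∀ {x y z} a b → x ≈ 0# → y ≈ 0# → z ≈ 0# → x + a * y + b * z ≈ 0#
  ≈0⇒x+a*y+b*z≈0 a b x≈0 y≈0 z≈0 = trans (+-cong (+-cong x≈0 (trans (*-congˡ y≈0) (zeroʳ a))) (trans (*-congˡ z≈0) (zeroʳ b)))
                                         (trans (+-identityʳ _) (+-identityʳ 0#))

-- Read a = q^p, b = q^j, Q = q^(j choose 2), F = [p+j]! and ⟨ q^k ⟩ = [k]_q: these are the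
-- recurrences of RightHandSide.rhsCoef with all q-integer denominators cleared, for the
-- coefficient of x^(p+1) and for the constant coefficient.
module LucasCoefficientIdentities {c ℓ} (R : CommutativeRing c ℓ) (u : CommutativeRing.Carrier R) where
  open import Data.Integer.Base using (+_)
  open CommutativeRing R
  open IntegerCoefficientSolver R

  ⟨_⟩ : Carrier → Carrier
  ⟨ z ⟩ = (1# - z) * u

  interior-identity : ∀ q a b Q F →
    Q * b * (F * ⟨ q * (a * b) ⟩ * ⟨ q * (q * (a * b)) ⟩) * ⟨ q * (q * (q * (a * (b * b)))) ⟩ * (⟨ q * (q * a) ⟩ * ⟨ q * (a * b) ⟩)
    ≈ Q * b * (F * ⟨ q * (a * b) ⟩) * ⟨ q * (q * (a * (b * b))) ⟩ * (⟨ q * a ⟩ * ⟨ q * (q * a) ⟩ * ⟨ q * (q * (a * b)) ⟩)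
      + - (1# - q * (q * a)) * (Q * (F * ⟨ q * (a * b) ⟩ * ⟨ q * (q * (a * b)) ⟩) * ⟨ q * (q * (a * (b * b))) ⟩ * (⟨ q * b ⟩ * ⟨ q * (a * b) ⟩))
      + Q * (F * ⟨ q * (a * b) ⟩) * ⟨ q * (a * (b * b)) ⟩ * (⟨ q * b ⟩ * ⟨ q * (q * a) ⟩ * ⟨ q * (q * (a * b)) ⟩)
  interior-identity q a b Q F = solve 6 (λ q a b u Q F → let ⟪_⟫ = λ z → (con (+ 1) :- z) :* u in
      Q :* b :* (F :* ⟪ q :* (a :* b) ⟫ :* ⟪ q :* (q :* (a :* b)) ⟫) :* ⟪ q :* (q :* (q :* (a :* (b :* b)))) ⟫ :* (⟪ q :* (q :* a) ⟫ :* ⟪ q :* (a :* b) ⟫)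
      := Q :* b :* (F :* ⟪ q :* (a :* b) ⟫) :* ⟪ q :* (q :* (a :* (b :* b))) ⟫ :* (⟪ q :* a ⟫ :* ⟪ q :* (q :* a) ⟫ :* ⟪ q :* (q :* (a :* b)) ⟫)
         :+ :- (con (+ 1) :- q :* (q :* a)) :* (Q :* (F :* ⟪ q :* (a :* b) ⟫ :* ⟪ q :* (q :* (a :* b)) ⟫) :* ⟪ q :* (q :* (a :* (b :* b))) ⟫ :* (⟪ q :* b ⟫ :* ⟪ q :* (a :* b) ⟫))
         :+ Q :* (F :* ⟪ q :* (a :* b) ⟫) :* ⟪ q :* (a :* (b :* b)) ⟫ :* (⟪ q :* b ⟫ :* ⟪ q :* (q :* a) ⟫ :* ⟪ q :* (q :* (a :* b)) ⟫))
    refl q a b u Q F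

  boundary-identity : ∀ q b Q F →
    Q * (q * b) * (F * ⟨ q * b ⟩ * ⟨ q * (q * b) ⟩) * ⟨ q * (q * ((q * b) * (q * b))) ⟩ * (⟨ q * 1# ⟩ * ⟨ q * b ⟩)
    ≈ - (1# - q * 1#) * (Q * (F * ⟨ q * b ⟩ * ⟨ q * (q * b) ⟩) * ⟨ q * ((q * b) * (q * b)) ⟩ * (⟨ q * (q * b) ⟩ * ⟨ q * b ⟩))
      + Q * (F * ⟨ q * b ⟩) * ⟨ (q * b) * (q * b) ⟩ * (⟨ q * (q * b) ⟩ * ⟨ q * 1# ⟩ * ⟨ q * (q * b) ⟩)
  boundary-identity q b Q F = solve 5 (λ q b u Q F → let ⟪_⟫ = λ z → (con (+ 1) :- z) :* u in
      Q :* (q :* b) :* (F :* ⟪ q :* b ⟫ :* ⟪ q :* (q :* b) ⟫) :* ⟪ q :* (q :* ((q :* b) :* (q :* b))) ⟫ :* (⟪ q :* con (+ 1) ⟫ :* ⟪ q :* b ⟫)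
      := :- (con (+ 1) :- q :* con (+ 1)) :* (Q :* (F :* ⟪ q :* b ⟫ :* ⟪ q :* (q :* b) ⟫) :* ⟪ q :* ((q :* b) :* (q :* b)) ⟫ :* (⟪ q :* (q :* b) ⟫ :* ⟪ q :* b ⟫))
         :+ Q :* (F :* ⟪ q :* b ⟫) :* ⟪ (q :* b) :* (q :* b) ⟫ :* (⟪ q :* (q :* b) ⟫ :* ⟪ q :* con (+ 1) ⟫ :* ⟪ q :* (q :* b) ⟫))
    refl q b u Q F

module LeftHandSide {c ℓ} (F : Field c ℓ) (q s : Field.Carrier F) where
  open import Data.Integer.Base using (+_)
  open Field F
  open FieldDefs F
  open FieldProperties F
  open IntegerCoefficientSolver commutativeRing
  open import Relation.Binary.Reasoning.Setoid setoid

  lowerCoef : ℕ → Carrier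
  lowerCoef k = ((q - 1#) * s) * ((1# - pow q (suc k)) * (1# - q) ⁻¹)

  Aop-≈ : ∀ p k → Aop q s p k ≈ mulX p k + lowerCoef k * p (suc k)
  Aop-≈ p k = +-congˡ (solve 5 (λ q s Q x v → (q :- con (+ 1)) :* s :* (((con (+ 1) :- Q) :* x) :* v)
                                         := (q :- con (+ 1)) :* s :* ((con (+ 1) :- Q) :* v) :* x)
                              refl q s (pow q (suc k)) (p (suc k)) ((1# - q) ⁻¹))

  mulX-cong : ∀ {p p′} → (∀ k → p k ≈ p′ k) → ∀ k → mulX p k ≈ mulX p′ k
  mulX-cong p≈p′ zero    = refl
  mulX-cong p≈p′ (suc k) = p≈p′ k

  Aop-cong : ∀ {p p′} → (∀ k → p k ≈ p′ k) → ∀ k → Aop q s p k ≈ Aop q s p′ k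
  Aop-cong {p} {p′} p≈p′ k = begin
    Aop q s p k                                ≈⟨ Aop-≈ p k ⟩
    mulX p k + lowerCoef k * p (suc k)         ≈⟨ +-cong (mulX-cong p≈p′ k) (*-congˡ (p≈p′ (suc k))) ⟩
    mulX p′ k + lowerCoef k * p′ (suc k)       ≈⟨ Aop-≈ p′ k ⟨
    Aop q s p′ k                               ∎

  Aop-linear : ∀ (a : ℕ → Carrier) (P : ℕ → Poly) N k →
    Aop q s (λ i → sumUpTo (λ j → a j * P j i) N) k ≈ sumUpTo (λ j → a j * Aop q s (P j) k) N
  Aop-linear a P N k = begin
    Aop q s (λ i → sumUpTo (λ j → a j * P j i) N) k
      ≈⟨ Aop-≈ _ k ⟩
    mulX (λ i → sumUpTo (λ j → a j * P j i) N) k + lowerCoef k * sumUpTo (λ j → a j * P j (suc k)) N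
      ≈⟨ +-cong (mulX-sum k) (sumUpTo-*ˡ (lowerCoef k) _ N) ⟨
    sumUpTo (λ j → a j * mulX (P j) k) N + sumUpTo (λ j → lowerCoef k * (a j * P j (suc k))) N
      ≈⟨ sumUpTo-+ _ _ N ⟨
    sumUpTo (λ j → a j * mulX (P j) k + lowerCoef k * (a j * P j (suc k))) N
      ≈⟨ sumUpTo-cong N (λ j _ → trans (factor (a j) (mulX (P j) k) (lowerCoef k) (P j (suc k)))
                                       (*-congˡ (sym (Aop-≈ (P j) k)))) ⟩
    sumUpTo (λ j → a j * Aop q s (P j) k) N ∎
    where
    factor : ∀ a m l x → a * m + l * (a * x) ≈ a * (m + l * x)
    factor = solve 4 (λ a m l x → a :* m :+ l :* (a :* x) := a :* (m :+ l :* x)) refl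
    mulX-sum : ∀ k → sumUpTo (λ j → a j * mulX (P j) k) N ≈ mulX (λ i → sumUpTo (λ j → a j * P j i) N) k
    mulX-sum zero    = sumUpTo-zero N (λ j _ → zeroʳ (a j))
    mulX-sum (suc k) = refl

  Aⁿ1 : ℕ → Poly
  Aⁿ1 m = iter (Aop q s) m onePoly

  lucTerm : ℕ → ℕ → Poly
  lucTerm n j k = fromℕ (lucasCoef n j) * pow s j * Aⁿ1 (n ∸ 2 ℕ.* j) k

  ALucTerm : ℕ → ℕ → Poly
  ALucTerm n j k = fromℕ (lucasCoef n j) * pow s j * Aⁿ1 (suc n ∸ 2 ℕ.* j) k

  coef0⇒term≈0 : ∀ n j x → lucasCoef n j ≡ 0 → fromℕ (lucasCoef n j) * pow s j * x ≈ 0#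
  coef0⇒term≈0 n j x eq rewrite eq = trans (*-congʳ (zeroˡ _)) (zeroˡ _)

  Luc-extend : ∀ n {B} → ⌊ suc n /2⌋ ≤ B → ∀ k → Luc q s (suc n) k ≈ sumUpTo (λ j → lucTerm (suc n) j k) B
  Luc-extend n ⌊1+n/2⌋≤B k = sym (sumUpTo-extend (λ j → lucTerm (suc n) j k) ⌊1+n/2⌋≤B
    (λ j ⌊1+n/2⌋<j → coef0⇒term≈0 (suc n) j _ (lucasCoef-vanish (suc n) j (⌊n/2⌋<m⇒n<m+m ⌊1+n/2⌋<j))))

  Aop-Luc : ∀ n {B} → ⌊ suc n /2⌋ ≤ B → ∀ k → Aop q s (Luc q s (suc n)) k ≈ sumUpTo (λ j → ALucTerm (suc n) j k) B
  Aop-Luc n {B} ⌊1+n/2⌋≤B k = begin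
    Aop q s (Luc q s (suc n)) k
      ≈⟨ Aop-cong (Luc-extend n ⌊1+n/2⌋≤B) k ⟩
    Aop q s (λ i → sumUpTo (λ j → lucTerm (suc n) j i) B) k
      ≈⟨ Aop-linear (λ j → fromℕ (lucasCoef (suc n) j) * pow s j) (λ j → Aⁿ1 (suc n ∸ 2 ℕ.* j)) B k ⟩
    sumUpTo (λ j → fromℕ (lucasCoef (suc n) j) * pow s j * Aop q s (Aⁿ1 (suc n ∸ 2 ℕ.* j)) k) B
      ≈⟨ sumUpTo-cong B (λ j _ → A-term j) ⟩
    sumUpTo (λ j → ALucTerm (suc n) j k) B ∎
    where
    A-term : ∀ j → fromℕ (lucasCoef (suc n) j) * pow s j * Aop q s (Aⁿ1 (suc n ∸ 2 ℕ.* j)) k ≈ ALucTerm (suc n) j k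
    A-term j with 2 ℕ.* j ℕ.≤? suc n
    ... | yes 2j≤1+n = reflexive (≡.cong (λ m → fromℕ (lucasCoef (suc n) j) * pow s j * Aⁿ1 m k) (≡.sym (ℕ.+-∸-assoc 1 2j≤1+n)))
    ... | no  2j≰1+n = trans (coef0⇒term≈0 (suc n) j _ coef≡0) (sym (coef0⇒term≈0 (suc n) j _ coef≡0))
      where coef≡0 = lucasCoef-vanish (suc n) j (≡.subst (suc n <_) (≡.cong (j ℕ.+_) (ℕ.+-identityʳ j)) (ℕ.≰⇒> 2j≰1+n))

  lucTerm-rec : ∀ n j k → 1 ≤ n →
    lucTerm (suc (suc n)) (suc j) k ≈ ALucTerm (suc n) (suc j) k + s * lucTerm n j k
  lucTerm-rec n j k 1≤n with j ℕ.<? n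
  ... | yes j<n = begin
    fromℕ (lucasCoef (suc (suc n)) (suc j)) * pow s (suc j) * Aⁿ1 (suc (suc n) ∸ 2 ℕ.* suc j) k
      ≡⟨ ≡.cong (λ m → fromℕ m * pow s (suc j) * Aⁿ1 (suc (suc n) ∸ 2 ℕ.* suc j) k) (lucasCoef-rec n j j<n) ⟩
    fromℕ (a ℕ.+ b) * (s * pow s j) * Aⁿ1 (suc (suc n) ∸ 2 ℕ.* suc j) k
      ≈⟨ *-congʳ (*-congʳ (fromℕ-+ a b)) ⟩
    (fromℕ a + fromℕ b) * (s * pow s j) * Aⁿ1 (suc (suc n) ∸ 2 ℕ.* suc j) k
      ≈⟨ solve 5 (λ a b s x y → (a :+ b) :* (s :* x) :* y := a :* (s :* x) :* y :+ s :* (b :* x :* y))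
               refl (fromℕ a) (fromℕ b) s (pow s j) _ ⟩
    ALucTerm (suc n) (suc j) k + s * (fromℕ b * pow s j * Aⁿ1 (suc (suc n) ∸ 2 ℕ.* suc j) k)
      ≡⟨ ≡.cong (λ m → ALucTerm (suc n) (suc j) k + s * (fromℕ b * pow s j * Aⁿ1 m k)) (2+n∸2[1+j]≡n∸2j n j) ⟩
    ALucTerm (suc n) (suc j) k + s * lucTerm n j k ∎
    where
    a = lucasCoef (suc n) (suc j)
    b = lucasCoef n j
  ... | no j≮n = begin
    lucTerm (suc (suc n)) (suc j) k
      ≈⟨ coef0⇒term≈0 (suc (suc n)) (suc j) _ (lucasCoef-vanish (suc (suc n)) (suc j) 2+n<2+2j) ⟩
    0#
      ≈⟨ trans (+-congˡ (zeroʳ s)) (+-identityʳ 0#) ⟨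
    0# + s * 0#
      ≈⟨ +-cong (coef0⇒term≈0 (suc n) (suc j) _ (lucasCoef-vanish (suc n) (suc j) 1+n<2+2j))
                (*-congˡ (coef0⇒term≈0 n j _ (lucasCoef-vanish n j n<2j))) ⟨
    ALucTerm (suc n) (suc j) k + s * lucTerm n j k ∎
    where
    n<2j = 0<m≤n⇒m<n+n 1≤n (ℕ.≮⇒≥ j≮n)
    2+n<2+2j = m<n+n⇒2+m<[1+n]+[1+n] n<2j
    1+n<2+2j = ℕ.<-trans (ℕ.n<1+n (suc n)) 2+n<2+2j

  Luc-rec : ∀ n → 1 ≤ n → ∀ k → Luc q s (suc (suc n)) k ≈ Aop q s (Luc q s (suc n)) k + s * Luc q s n k
  Luc-rec n@(suc m) 1≤n k = begin
    Luc q s (suc (suc n)) k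
      ≈⟨ Luc-extend (suc n) (ℕ.⌊n/2⌋≤n (suc (suc n))) k ⟩
    sumUpTo (λ j → lucTerm (suc (suc n)) j k) (suc (suc n))
      ≈⟨ sumUpTo-unfoldˡ _ (suc n) ⟩
    lucTerm (suc (suc n)) 0 k + sumUpTo (λ j → lucTerm (suc (suc n)) (suc j) k) (suc n)
      ≈⟨ +-cong lucTerm-0 (sumUpTo-cong (suc n) (λ j _ → lucTerm-rec n j k 1≤n)) ⟩
    ALucTerm (suc n) 0 k + sumUpTo (λ j → ALucTerm (suc n) (suc j) k + s * lucTerm n j k) (suc n)
      ≈⟨ +-congˡ (sumUpTo-+ _ _ (suc n)) ⟩
    ALucTerm (suc n) 0 k + (sumUpTo (λ j → ALucTerm (suc n) (suc j) k) (suc n) + sumUpTo (λ j → s * lucTerm n j k) (suc n))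
      ≈⟨ +-assoc _ _ _ ⟨
    ALucTerm (suc n) 0 k + sumUpTo (λ j → ALucTerm (suc n) (suc j) k) (suc n) + sumUpTo (λ j → s * lucTerm n j k) (suc n)
      ≈⟨ +-cong (sym (sumUpTo-unfoldˡ _ (suc n))) (sumUpTo-*ˡ s _ (suc n)) ⟩
    sumUpTo (λ j → ALucTerm (suc n) j k) (suc (suc n)) + s * sumUpTo (λ j → lucTerm n j k) (suc n)
      ≈⟨ +-cong (Aop-Luc n (ℕ.m≤n⇒m≤1+n (ℕ.⌊n/2⌋≤n (suc n))) k) (*-congˡ (Luc-extend m (ℕ.m≤n⇒m≤1+n (ℕ.⌊n/2⌋≤n n)) k)) ⟨
    Aop q s (Luc q s (suc n)) k + s * Luc q s n k ∎
    where
    lucTerm-0 : lucTerm (suc (suc n)) 0 k ≈ ALucTerm (suc n) 0 k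
    lucTerm-0 rewrite lucasCoef-0 (suc n) | lucasCoef-0 n = refl

  Aop-onePoly : ∀ k → Aop q s onePoly k ≈ mulX onePoly k
  Aop-onePoly k = trans (Aop-≈ onePoly k) (trans (+-congˡ (zeroʳ _)) (+-identityʳ _))

  Luc-1 : ∀ k → Luc q s 1 k ≈ Aop q s onePoly k
  Luc-1 k = trans (*-congʳ (trans (*-identityʳ _) (+-identityʳ 1#))) (*-identityˡ _)

  Luc-2 : ∀ k → Luc q s 2 k ≈ Aop q s (Luc q s 1) k + s * Luc q s 0 k
  Luc-2 k = begin
    (1# + 0#) * 1# * Aop q s (Aop q s onePoly) k + (1# + (1# + 0#)) * (s * 1#) * onePoly k
      ≈⟨ solve 3 (λ x s y → (con (+ 1) :+ con (+ 0)) :* con (+ 1) :* x :+ (con (+ 1) :+ (con (+ 1) :+ con (+ 0))) :* (s :* con (+ 1)) :* y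
                            := x :+ s :* ((con (+ 1) :+ con (+ 1)) :* y))
               refl (Aop q s (Aop q s onePoly) k) s (onePoly k) ⟩
    Aop q s (Aop q s onePoly) k + s * ((1# + 1#) * onePoly k)
      ≈⟨ +-congʳ (Aop-cong Luc-1 k) ⟨
    Aop q s (Luc q s 1) k + s * Luc q s 0 k ∎

module RightHandSide {c ℓ} (F : Field c ℓ) (q s : Field.Carrier F) where
  open import Data.Integer.Base using (+_)
  open Field F
  open FieldDefs F
  open FieldProperties F
  open import Relation.Binary.Reasoning.Setoid setoid

  rhsCoef : ℕ → ℕ → Carrier
  rhsCoef n j = pow q (j C 2) * qbinom q (n ∸ j) j * (qint q n / qint q (n ∸ j))

  mono-≢ : ∀ {m k} → k ≢ m → mono m k ≡ 0#
  mono-≢ {m} {k} k≢m rewrite dec-false (k ℕ.≟ m) k≢m = ≡.refl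

  mono-≡ : ∀ k → mono k k ≡ 1#
  mono-≡ k rewrite dec-true (k ℕ.≟ k) ≡.refl = ≡.refl

  private
    rhsTerm≈0 : ∀ n j k → k ≢ n ∸ 2 ℕ.* j → rhsCoef n j * pow s j * mono (n ∸ 2 ℕ.* j) k ≈ 0#
    rhsTerm≈0 n j k k≢ rewrite mono-≢ k≢ = zeroʳ _

    exponent⇒gap : ∀ n j k → j ≤ ⌊ n /2⌋ → k ≡ n ∸ 2 ℕ.* j → n ≡ k ℕ.+ (j ℕ.+ j)
    exponent⇒gap n j k j≤ k≡ = ≡.sym (≡.trans (≡.cong₂ ℕ._+_ k≡ (≡.sym 2j≡j+j))
      (ℕ.m∸n+n≡m (≡.subst (_≤ n) (≡.sym 2j≡j+j) (m≤⌊n/2⌋⇒m+m≤n n j j≤))))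
      where 2j≡j+j = ≡.cong (j ℕ.+_) (ℕ.+-identityʳ j)

  lucRHS-below : ∀ {n k} → n < k → lucRHS q s n k ≈ 0#
  lucRHS-below {n} {k} n<k = sumUpTo-zero ⌊ n /2⌋ (λ j _ → rhsTerm≈0 n j k
    (λ k≡ → ℕ.<⇒≱ n<k (≡.subst (_≤ n) (≡.sym k≡) (ℕ.m∸n≤m n (2 ℕ.* j)))))

  lucRHS-even : ∀ {n} k J → n ≡ k ℕ.+ (J ℕ.+ J) → lucRHS q s n k ≈ rhsCoef n J * pow s J
  lucRHS-even {n} k J n≡ =
    trans (sumUpTo-single ⌊ n /2⌋ J J≤⌊n/2⌋ others) (trans (reflexive term-J) (*-identityʳ _))
    where
    J≤⌊n/2⌋ = m+m≤n⇒m≤⌊n/2⌋ (≡.subst (J ℕ.+ J ≤_) (≡.sym n≡) (ℕ.m≤n+m (J ℕ.+ J) k))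
    others : ∀ j → j ≤ ⌊ n /2⌋ → j ≢ J → rhsCoef n j * pow s j * mono (n ∸ 2 ℕ.* j) k ≈ 0#
    others j j≤ j≢J = rhsTerm≈0 n j k (λ k≡ → j≢J (m+m≡n+n⇒m≡n
      (ℕ.+-cancelˡ-≡ k _ _ (≡.trans (≡.sym (exponent⇒gap n j k j≤ k≡)) n≡))))
    term-J : rhsCoef n J * pow s J * mono (n ∸ 2 ℕ.* J) k ≡ rhsCoef n J * pow s J * 1#
    term-J rewrite n≡ | ℕ.+-identityʳ J | ℕ.m+n∸n≡m k (J ℕ.+ J) | mono-≡ k = ≡.refl

  lucRHS-odd : ∀ {n} k J → n ≡ k ℕ.+ suc (J ℕ.+ J) → lucRHS q s n k ≈ 0#
  lucRHS-odd {n} k J n≡ = sumUpTo-zero ⌊ n /2⌋ (λ j j≤ → rhsTerm≈0 n j k (λ k≡ →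
    1+m+m≢n+n J j (ℕ.+-cancelˡ-≡ k _ _ (≡.trans (≡.sym n≡) (exponent⇒gap n j k j≤ k≡)))))

  module Nondegenerate (q≉1 : ¬ (q ≈ 1#)) (n₀ : ℕ) (q^k≉1 : ∀ k → 1 ≤ k → k ≤ n₀ → ¬ (pow q k ≈ 1#)) where
    open IntegerCoefficientSolver commutativeRing
    open import Algebra.Properties.Group +-group using (x∙y⁻¹≈ε⇒x≈y)

    u : Carrier
    u = (1# - q) ⁻¹

    [1-q]u≈1 : (1# - q) * u ≈ 1#
    [1-q]u≈1 = ⁻¹-inverse _ (λ 1-q≈0 → q≉1 (sym (x∙y⁻¹≈ε⇒x≈y 1# q 1-q≈0)))

    qint≉0 : ∀ m → 1 ≤ m → m ≤ n₀ → ¬ (qint q m ≈ 0#)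
    qint≉0 m 1≤m m≤n₀ = *-nonzero (λ 1-q^m≈0 → q^k≉1 m 1≤m m≤n₀ (sym (x∙y⁻¹≈ε⇒x≈y 1# _ 1-q^m≈0)))
                                 (λ u≈0 → 0≉1 (trans (sym (zeroʳ _)) (trans (*-congˡ (sym u≈0)) [1-q]u≈1)))

    qfact≉0 : ∀ m → m ≤ n₀ → ¬ (qfact q m ≈ 0#)
    qfact≉0 zero    _       = 1≉0
    qfact≉0 (suc m) 1+m≤n₀ = *-nonzero (qfact≉0 m (ℕ.<⇒≤ 1+m≤n₀)) (qint≉0 (suc m) (s≤s z≤n) 1+m≤n₀)

    lowering : ℕ → Carrier
    lowering k = - (s * (1# - pow q (suc k)))

    lowerCoef≈lowering : ∀ k → LeftHandSide.lowerCoef F q s k ≈ lowering k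
    lowerCoef≈lowering k = begin
      ((q - 1#) * s) * ((1# - Q) * u)   ≈⟨ solve 4 (λ q s Q u → (q :- con (+ 1)) :* s :* ((con (+ 1) :- Q) :* u)
                                                      := :- ((con (+ 1) :- q) :* u) :* (s :* (con (+ 1) :- Q))) refl q s Q u ⟩
      - ((1# - q) * u) * (s * (1# - Q)) ≈⟨ *-congʳ (-‿cong [1-q]u≈1) ⟩
      - 1# * (s * (1# - Q))             ≈⟨ solve 1 (λ x → :- con (+ 1) :* x := :- x) refl _ ⟩
      - (s * (1# - Q))                  ∎
      where Q = pow q (suc k)

    Aop-lowering : ∀ p k → Aop q s p k ≈ mulX p k + lowering k * p (suc k)
    Aop-lowering p k = trans (LeftHandSide.Aop-≈ F q s p k) (+-congˡ (*-congʳ (lowerCoef≈lowering k)))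

    rhsCoef-cleared : ∀ P J {m n} → m ≡ P ℕ.+ J → n ≡ m ℕ.+ J → 1 ≤ m → n ≤ n₀ →
      rhsCoef n J * (qfact q J * qfact q P * qint q m) ≈ pow q (J C 2) * qfact q m * qint q n
    rhsCoef-cleared P J {m} {n} ≡.refl ≡.refl 1≤m n≤n₀ = begin
      rhsCoef n J * (d * [m])
        ≡⟨ ≡.cong (λ x → x * (d * [m])) (≡.cong₂ (λ a b → Q * (qfact q a / (qfact q J * qfact q b)) * ([n] / qint q a))
                                                  (ℕ.m+n∸n≡m m J) (≡.trans (≡.cong (_∸ J) (ℕ.m+n∸n≡m m J)) (ℕ.m+n∸n≡m P J))) ⟩
      Q * ([m]! * d ⁻¹) * ([n] * [m] ⁻¹) * (d * [m])
        ≈⟨ solve 7 (λ Q f d d′ n m m′ → Q :* (f :* d′) :* (n :* m′) :* (d :* m) := Q :* f :* n :* (d :* d′) :* (m :* m′))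
                 refl Q [m]! d (d ⁻¹) [n] [m] ([m] ⁻¹) ⟩
      Q * [m]! * [n] * (d * d ⁻¹) * ([m] * [m] ⁻¹)
        ≈⟨ *-cong (*-congˡ (⁻¹-inverse d (*-nonzero (qfact≉0 J J≤n₀) (qfact≉0 P P≤n₀)))) (⁻¹-inverse [m] (qint≉0 m 1≤m m≤n₀)) ⟩
      Q * [m]! * [n] * 1# * 1#
        ≈⟨ trans (*-identityʳ _) (*-identityʳ _) ⟩
      Q * [m]! * [n] ∎
      where
      Q = pow q (J C 2)
      d = qfact q J * qfact q P
      [m] = qint q m
      [m]! = qfact q m
      [n] = qint q n
      m≤n₀ = ℕ.≤-trans (ℕ.m≤m+n m J) n≤n₀
      J≤n₀ = ℕ.≤-trans (ℕ.m≤n+m J P) m≤n₀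
      P≤n₀ = ℕ.≤-trans (ℕ.m≤m+n P J) m≤n₀

    rhsCoef-0 : ∀ m → 1 ≤ m → m ≤ n₀ → rhsCoef m 0 ≈ 1#
    rhsCoef-0 m 1≤m m≤n₀ = *-cancelʳ d≉0
      (trans (rhsCoef-cleared m 0 m≡m+0 m≡m+0 1≤m m≤n₀) (sym (*-identityˡ _)))
      where
      m≡m+0 = ≡.sym (ℕ.+-identityʳ m)
      d≉0 = *-nonzero (*-nonzero 1≉0 (qfact≉0 m m≤n₀)) (qint≉0 m 1≤m m≤n₀)

    open LucasCoefficientIdentities commutativeRing u

    qint≈⟨⟩ : ∀ m {z} → pow q m ≈ z → qint q m ≈ ⟨ z ⟩
    qint≈⟨⟩ m q^m≈z = *-congʳ (+-congˡ (-‿cong q^m≈z))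

    pow-[1+j]C2 : ∀ j → pow q (suc j C 2) ≈ pow q (j C 2) * pow q j
    pow-[1+j]C2 j = trans (reflexive (≡.cong (pow q) ([1+n]C2≡nC2+n j))) (pow-+ q (j C 2) j)

    rhsCoef-rec : ∀ p j {N} → N ≡ suc p ℕ.+ (j ℕ.+ j) → suc (suc N) ≤ n₀ →
      rhsCoef (suc (suc N)) (suc j)
        ≈ rhsCoef (suc N) (suc j) + - (1# - pow q (suc (suc p))) * rhsCoef (suc N) j + rhsCoef N j
    rhsCoef-rec p j {N} N≡ 2+N≤n₀ = *-cancelʳ D≉0 (begin
      L * D                                ≈⟨ L-cleared ⟩
      XL                                   ≈⟨ interior-identity q a b Q [m]! ⟩
      X₁ + - e * X₂ + X₃                   ≈⟨ +-cong (+-cong T₁-cleared (*-congˡ T₂-cleared)) T₃-cleared ⟨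
      T₁ * D + - e * (T₂ * D) + T₃ * D     ≈⟨ solve 5 (λ x y z e d → x :* d :+ e :* (y :* d) :+ z :* d := (x :+ e :* y :+ z) :* d)
                                                    refl T₁ T₂ T₃ (- e) D ⟩
      (T₁ + - e * T₂ + T₃) * D             ∎)
      where
      m = p ℕ.+ j
      a = pow q p
      b = pow q j
      e = 1# - pow q (suc (suc p))
      Q = pow q (j C 2)
      [m]! = qfact q m
      L = rhsCoef (suc (suc N)) (suc j)
      T₁ = rhsCoef (suc N) (suc j)
      T₂ = rhsCoef (suc N) j
      T₃ = rhsCoef N j
      D = qfact q j * qint q (suc j) * (qfact q p * qint q (suc p) * qint q (suc (suc p))) * qint q (suc (suc m)) * qint q (suc m)
      XL = Q * b * ([m]! * ⟨ q * (a * b) ⟩ * ⟨ q * (q * (a * b)) ⟩) * ⟨ q * (q * (q * (a * (b * b)))) ⟩ * (⟨ q * (q * a) ⟩ * ⟨ q * (a * b) ⟩)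
      X₁ = Q * b * ([m]! * ⟨ q * (a * b) ⟩) * ⟨ q * (q * (a * (b * b))) ⟩ * (⟨ q * a ⟩ * ⟨ q * (q * a) ⟩ * ⟨ q * (q * (a * b)) ⟩)
      X₂ = Q * ([m]! * ⟨ q * (a * b) ⟩ * ⟨ q * (q * (a * b)) ⟩) * ⟨ q * (q * (a * (b * b))) ⟩ * (⟨ q * b ⟩ * ⟨ q * (a * b) ⟩)
      X₃ = Q * ([m]! * ⟨ q * (a * b) ⟩) * ⟨ q * (a * (b * b)) ⟩ * (⟨ q * b ⟩ * ⟨ q * (q * a) ⟩ * ⟨ q * (q * (a * b)) ⟩)

      N≡1+m+j : N ≡ suc m ℕ.+ j
      N≡1+m+j = ≡.trans N≡ (≡.cong suc (≡.sym (ℕ.+-assoc p j j)))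
      N≡m+1+j : N ≡ m ℕ.+ suc j
      N≡m+1+j = ≡.trans N≡1+m+j (≡.sym (ℕ.+-suc m j))
      1+N≤n₀ = ℕ.≤-trans (ℕ.n≤1+n _) 2+N≤n₀
      N≤n₀ = ℕ.≤-trans (ℕ.n≤1+n _) 1+N≤n₀
      2+m≤n₀ : suc (suc m) ≤ n₀
      2+m≤n₀ = ℕ.≤-trans (s≤s (s≤s (ℕ.≤-trans (ℕ.m≤m+n m j) (ℕ.≤-reflexive (ℕ.+-assoc p j j)))))
                          (ℕ.≤-trans (ℕ.≤-reflexive (≡.cong suc (≡.sym N≡))) 1+N≤n₀)
      D≉0 : ¬ (D ≈ 0#)
      D≉0 = *-nonzero (*-nonzero (*-nonzero (qfact≉0 (suc j) (ℕ.≤-trans (s≤s (ℕ.m≤n+m j p)) (ℕ.≤-trans (ℕ.n≤1+n _) 2+m≤n₀)))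
                                            (qfact≉0 (suc (suc p)) (ℕ.≤-trans (s≤s (s≤s (ℕ.m≤m+n p j))) 2+m≤n₀)))
                                 (qint≉0 _ (s≤s z≤n) 2+m≤n₀))
                      (qint≉0 _ (s≤s z≤n) (ℕ.≤-trans (ℕ.n≤1+n _) 2+m≤n₀))

      q^m≈ab : pow q m ≈ a * b
      q^m≈ab = pow-+ q p j
      q^N≈qabb : pow q N ≈ q * (a * (b * b))
      q^N≈qabb = trans (reflexive (≡.cong (pow q) N≡)) (*-congˡ (trans (pow-+ q p (j ℕ.+ j)) (*-congˡ (pow-+ q j j))))
      [m+1]≈ = qint≈⟨⟩ (suc m) (*-congˡ q^m≈ab)
      [m+2]≈ = qint≈⟨⟩ (suc (suc m)) (*-congˡ (*-congˡ q^m≈ab))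

      L-cleared : L * D ≈ XL
      L-cleared = begin
        L * D
          ≈⟨ solve 8 (λ T x y z v w g h → T :* (x :* y :* (z :* v :* w) :* g :* h) := T :* (x :* y :* (z :* v) :* g) :* (w :* h))
                   refl L _ _ _ _ _ _ _ ⟩
        L * (qfact q (suc j) * qfact q (suc p) * qint q (suc (suc m))) * (qint q (suc (suc p)) * qint q (suc m))
          ≈⟨ *-congʳ (rhsCoef-cleared (suc p) (suc j) (≡.cong suc (≡.sym (ℕ.+-suc p j))) (≡.cong (suc ∘ suc) N≡m+1+j) (s≤s z≤n) 2+N≤n₀) ⟩
        pow q (suc j C 2) * ([m]! * qint q (suc m) * qint q (suc (suc m))) * qint q (suc (suc N)) * (qint q (suc (suc p)) * qint q (suc m))
          ≈⟨ *-cong (*-cong (*-cong (pow-[1+j]C2 j) (*-cong (*-congˡ [m+1]≈) [m+2]≈)) (qint≈⟨⟩ (suc (suc N)) (*-congˡ (*-congˡ q^N≈qabb))))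
                    (*-congˡ [m+1]≈) ⟩
        XL ∎

      T₁-cleared : T₁ * D ≈ X₁
      T₁-cleared = begin
        T₁ * D
          ≈⟨ solve 8 (λ T x y z v w g h → T :* (x :* y :* (z :* v :* w) :* g :* h) := T :* (x :* y :* z :* h) :* (v :* w :* g))
                   refl T₁ _ _ _ _ _ _ _ ⟩
        T₁ * (qfact q (suc j) * qfact q p * qint q (suc m)) * (qint q (suc p) * qint q (suc (suc p)) * qint q (suc (suc m)))
          ≈⟨ *-congʳ (rhsCoef-cleared p (suc j) (≡.sym (ℕ.+-suc p j)) (≡.cong suc N≡m+1+j) (s≤s z≤n) 1+N≤n₀) ⟩
        pow q (suc j C 2) * ([m]! * qint q (suc m)) * qint q (suc N) * (qint q (suc p) * qint q (suc (suc p)) * qint q (suc (suc m)))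
          ≈⟨ *-cong (*-cong (*-cong (pow-[1+j]C2 j) (*-congˡ [m+1]≈)) (qint≈⟨⟩ (suc N) (*-congˡ q^N≈qabb))) (*-congˡ [m+2]≈) ⟩
        X₁ ∎

      T₂-cleared : T₂ * D ≈ X₂
      T₂-cleared = begin
        T₂ * D
          ≈⟨ solve 8 (λ T x y z v w g h → T :* (x :* y :* (z :* v :* w) :* g :* h) := T :* (x :* (z :* v :* w) :* g) :* (y :* h))
                   refl T₂ _ _ _ _ _ _ _ ⟩
        T₂ * (qfact q j * qfact q (suc (suc p)) * qint q (suc (suc m))) * (qint q (suc j) * qint q (suc m))
          ≈⟨ *-congʳ (rhsCoef-cleared (suc (suc p)) j ≡.refl (≡.cong suc N≡1+m+j) (s≤s z≤n) 1+N≤n₀) ⟩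
        Q * ([m]! * qint q (suc m) * qint q (suc (suc m))) * qint q (suc N) * (qint q (suc j) * qint q (suc m))
          ≈⟨ *-cong (*-cong (*-congˡ (*-cong (*-congˡ [m+1]≈) [m+2]≈)) (qint≈⟨⟩ (suc N) (*-congˡ q^N≈qabb))) (*-congˡ [m+1]≈) ⟩
        X₂ ∎

      T₃-cleared : T₃ * D ≈ X₃
      T₃-cleared = begin
        T₃ * D
          ≈⟨ solve 8 (λ T x y z v w g h → T :* (x :* y :* (z :* v :* w) :* g :* h) := T :* (x :* (z :* v) :* h) :* (y :* w :* g))
                   refl T₃ _ _ _ _ _ _ _ ⟩
        T₃ * (qfact q j * qfact q (suc p) * qint q (suc m)) * (qint q (suc j) * qint q (suc (suc p)) * qint q (suc (suc m)))
          ≈⟨ *-congʳ (rhsCoef-cleared (suc p) j ≡.refl N≡1+m+j (s≤s z≤n) N≤n₀) ⟩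
        Q * ([m]! * qint q (suc m)) * qint q N * (qint q (suc j) * qint q (suc (suc p)) * qint q (suc (suc m)))
          ≈⟨ *-cong (*-cong (*-congˡ (*-congˡ [m+1]≈)) (qint≈⟨⟩ N q^N≈qabb)) (*-congˡ [m+2]≈) ⟩
        X₃ ∎

    rhsCoef-rec₀ : ∀ j {N} → N ≡ suc j ℕ.+ suc j → suc (suc N) ≤ n₀ →
      rhsCoef (suc (suc N)) (suc (suc j)) ≈ - (1# - pow q 1) * rhsCoef (suc N) (suc j) + rhsCoef N (suc j)
    rhsCoef-rec₀ j {N} N≡ 2+N≤n₀ = *-cancelʳ D≉0 (begin
      L * D                              ≈⟨ L-cleared ⟩
      XL                                 ≈⟨ boundary-identity q b Q [j]! ⟩
      - e * X₂ + X₃                      ≈⟨ +-cong (*-congˡ T₂-cleared) T₃-cleared ⟨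
      - e * (T₂ * D) + T₃ * D            ≈⟨ solve 4 (λ y z e d → e :* (y :* d) :+ z :* d := (e :* y :+ z) :* d) refl T₂ T₃ (- e) D ⟩
      (- e * T₂ + T₃) * D                ∎)
      where
      b = pow q j
      e = 1# - pow q 1
      Q = pow q (suc j C 2)
      [j]! = qfact q j
      L = rhsCoef (suc (suc N)) (suc (suc j))
      T₂ = rhsCoef (suc N) (suc j)
      T₃ = rhsCoef N (suc j)
      D = qfact q (suc (suc j)) * qfact q 1 * qint q (suc (suc j)) * qint q (suc j)
      XL = Q * (q * b) * ([j]! * ⟨ q * b ⟩ * ⟨ q * (q * b) ⟩) * ⟨ q * (q * ((q * b) * (q * b))) ⟩ * (⟨ q * 1# ⟩ * ⟨ q * b ⟩)
      X₂ = Q * ([j]! * ⟨ q * b ⟩ * ⟨ q * (q * b) ⟩) * ⟨ q * ((q * b) * (q * b)) ⟩ * (⟨ q * (q * b) ⟩ * ⟨ q * b ⟩)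
      X₃ = Q * ([j]! * ⟨ q * b ⟩) * ⟨ (q * b) * (q * b) ⟩ * (⟨ q * (q * b) ⟩ * ⟨ q * 1# ⟩ * ⟨ q * (q * b) ⟩)

      2+N≡ : suc (suc N) ≡ suc (suc j) ℕ.+ suc (suc j)
      2+N≡ = ≡.trans (≡.cong (suc ∘ suc) N≡) (≡.cong suc (≡.sym (ℕ.+-suc (suc j) (suc j))))
      1+N≤n₀ = ℕ.≤-trans (ℕ.n≤1+n _) 2+N≤n₀
      N≤n₀ = ℕ.≤-trans (ℕ.n≤1+n _) 1+N≤n₀
      2+j≤n₀ : suc (suc j) ≤ n₀
      2+j≤n₀ = ℕ.≤-trans (ℕ.≤-trans (ℕ.m≤m+n (suc (suc j)) (suc (suc j))) (ℕ.≤-reflexive (≡.sym 2+N≡))) 2+N≤n₀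
      D≉0 : ¬ (D ≈ 0#)
      D≉0 = *-nonzero (*-nonzero (*-nonzero (qfact≉0 (suc (suc j)) 2+j≤n₀) (qfact≉0 1 (ℕ.≤-trans (s≤s z≤n) 2+j≤n₀)))
                                 (qint≉0 _ (s≤s z≤n) 2+j≤n₀))
                      (qint≉0 _ (s≤s z≤n) (ℕ.≤-trans (ℕ.n≤1+n _) 2+j≤n₀))
      q^N≈ : pow q N ≈ (q * b) * (q * b)
      q^N≈ = trans (reflexive (≡.cong (pow q) N≡)) (pow-+ q (suc j) (suc j))

      L-cleared : L * D ≈ XL
      L-cleared = begin
        L * D
          ≈⟨ solve 6 (λ T f o g h k → T :* (f :* (o :* g) :* h :* k) := T :* (f :* o :* h) :* (g :* k))
                   refl L (qfact q (suc (suc j))) 1# (qint q 1) (qint q (suc (suc j))) (qint q (suc j)) ⟩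
        L * (qfact q (suc (suc j)) * 1# * qint q (suc (suc j))) * (qint q 1 * qint q (suc j))
          ≈⟨ *-congʳ (rhsCoef-cleared 0 (suc (suc j)) ≡.refl 2+N≡ (s≤s z≤n) 2+N≤n₀) ⟩
        pow q (suc (suc j) C 2) * qfact q (suc (suc j)) * qint q (suc (suc N)) * (qint q 1 * qint q (suc j))
          ≈⟨ *-congʳ (*-cong (*-congʳ (pow-[1+j]C2 (suc j))) (qint≈⟨⟩ (suc (suc N)) (*-congˡ (*-congˡ q^N≈)))) ⟩
        XL ∎

      T₂-cleared : T₂ * D ≈ X₂
      T₂-cleared = begin
        T₂ * D
          ≈⟨ solve 6 (λ T f g₁ g₂ o h → T :* (f :* g₁ :* g₂ :* (o :* h) :* g₂ :* g₁) := T :* (f :* g₁ :* (o :* h) :* g₂) :* (g₂ :* g₁))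
                   refl T₂ [j]! (qint q (suc j)) (qint q (suc (suc j))) 1# (qint q 1) ⟩
        T₂ * (qfact q (suc j) * qfact q 1 * qint q (suc (suc j))) * (qint q (suc (suc j)) * qint q (suc j))
          ≈⟨ *-congʳ (rhsCoef-cleared 1 (suc j) ≡.refl (≡.cong suc N≡) (s≤s z≤n) 1+N≤n₀) ⟩
        Q * qfact q (suc (suc j)) * qint q (suc N) * (qint q (suc (suc j)) * qint q (suc j))
          ≈⟨ *-congʳ (*-congˡ (qint≈⟨⟩ (suc N) (*-congˡ q^N≈))) ⟩
        X₂ ∎

      T₃-cleared : T₃ * D ≈ X₃
      T₃-cleared = begin
        T₃ * D
          ≈⟨ solve 6 (λ T f g₁ g₂ o h → T :* (f :* g₁ :* g₂ :* (o :* h) :* g₂ :* g₁) := T :* (f :* g₁ :* o :* g₁) :* (g₂ :* h :* g₂))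
                   refl T₃ [j]! (qint q (suc j)) (qint q (suc (suc j))) 1# (qint q 1) ⟩
        T₃ * (qfact q (suc j) * qfact q 0 * qint q (suc j)) * (qint q (suc (suc j)) * qint q 1 * qint q (suc (suc j)))
          ≈⟨ *-congʳ (rhsCoef-cleared 0 (suc j) ≡.refl N≡ (s≤s z≤n) N≤n₀) ⟩
        Q * qfact q (suc j) * qint q N * (qint q (suc (suc j)) * qint q 1 * qint q (suc (suc j)))
          ≈⟨ *-congʳ (*-congˡ (qint≈⟨⟩ N q^N≈)) ⟩
        X₃ ∎

    rhsCoef-2-1 : 2 ≤ n₀ → rhsCoef 2 1 ≈ 1# + q
    rhsCoef-2-1 2≤n₀ = *-cancelʳ D≉0 (begin
      rhsCoef 2 1 * D                            ≈⟨ rhsCoef-cleared 0 1 ≡.refl ≡.refl (s≤s z≤n) 2≤n₀ ⟩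
      pow q (1 C 2) * qfact q 1 * qint q 2       ≈⟨ solve 2 (λ q u → let ⟪_⟫ = λ z → (con (+ 1) :- z) :* u in
                                                      con (+ 1) :* (con (+ 1) :* ⟪ q :* con (+ 1) ⟫) :* ⟪ q :* (q :* con (+ 1)) ⟫
                                                      := (con (+ 1) :+ q) :* (con (+ 1) :* ⟪ q :* con (+ 1) ⟫ :* con (+ 1) :* ⟪ q :* con (+ 1) ⟫))
                                                    refl q u ⟩
      (1# + q) * D                               ∎)
      where
      D = qfact q 1 * qfact q 0 * qint q 1
      1≤n₀ = ℕ.≤-trans (s≤s z≤n) 2≤n₀
      D≉0 = *-nonzero (*-nonzero (qfact≉0 1 1≤n₀) 1≉0) (qint≉0 1 (s≤s z≤n) 1≤n₀)

    lucRHS-top : ∀ n → 1 ≤ n → n ≤ n₀ → lucRHS q s n n ≈ 1#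
    lucRHS-top n 1≤n n≤n₀ = trans (lucRHS-even n 0 (≡.sym (ℕ.+-identityʳ n))) (trans (*-identityʳ _) (rhsCoef-0 n 1≤n n≤n₀))

    stepCoef : ℕ → ℕ → Carrier
    stepCoef N k = mulX (lucRHS q s (suc N)) k + lowering k * lucRHS q s (suc N) (suc k) + s * lucRHS q s N k

    lucRHS-step-boundary : ∀ {N} j → N ≡ suc j ℕ.+ suc j → suc (suc N) ≤ n₀ →
      lucRHS q s (suc (suc N)) 0 ≈ stepCoef N 0
    lucRHS-step-boundary {N} j N≡ 2+N≤n₀ = begin
      lucRHS q s (suc (suc N)) 0
        ≈⟨ lucRHS-even 0 (suc (suc j)) 2+N≡ ⟩
      rhsCoef (suc (suc N)) (suc (suc j)) * (s * pow s (suc j))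
        ≈⟨ *-congʳ (rhsCoef-rec₀ j N≡ 2+N≤n₀) ⟩
      (- (1# - pow q 1) * rhsCoef (suc N) (suc j) + rhsCoef N (suc j)) * (s * pow s (suc j))
        ≈⟨ solve 5 (λ e x y s t → (:- e :* x :+ y) :* (s :* t) := con (+ 0) :+ :- (s :* e) :* (x :* t) :+ s :* (y :* t))
                 refl (1# - pow q 1) (rhsCoef (suc N) (suc j)) (rhsCoef N (suc j)) s (pow s (suc j)) ⟩
      0# + lowering 0 * (rhsCoef (suc N) (suc j) * pow s (suc j)) + s * (rhsCoef N (suc j) * pow s (suc j))
        ≈⟨ +-cong (+-congˡ (*-congˡ (lucRHS-even 1 (suc j) (≡.cong suc N≡)))) (*-congˡ (lucRHS-even 0 (suc j) N≡)) ⟨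
      stepCoef N 0 ∎
      where
      2+N≡ : suc (suc N) ≡ suc (suc j) ℕ.+ suc (suc j)
      2+N≡ = ≡.trans (≡.cong (suc ∘ suc) N≡) (≡.sym (k+[1+j+1+j]≡2+k+2j 0 (suc j)))

    lucRHS-step-interior : ∀ {N} p j → N ≡ suc p ℕ.+ (j ℕ.+ j) → suc (suc N) ≤ n₀ →
      lucRHS q s (suc (suc N)) (suc p) ≈ stepCoef N (suc p)
    lucRHS-step-interior {N} p j N≡ 2+N≤n₀ = begin
      lucRHS q s (suc (suc N)) (suc p)
        ≈⟨ lucRHS-even (suc p) (suc j) 2+N≡ ⟩
      rhsCoef (suc (suc N)) (suc j) * (s * pow s j)
        ≈⟨ *-congʳ (rhsCoef-rec p j N≡ 2+N≤n₀) ⟩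
      (rhsCoef (suc N) (suc j) + - (1# - pow q (suc (suc p))) * rhsCoef (suc N) j + rhsCoef N j) * (s * pow s j)
        ≈⟨ solve 6 (λ x e y z s t → (x :+ :- e :* y :+ z) :* (s :* t) := x :* (s :* t) :+ :- (s :* e) :* (y :* t) :+ s :* (z :* t))
                 refl (rhsCoef (suc N) (suc j)) (1# - pow q (suc (suc p))) (rhsCoef (suc N) j) (rhsCoef N j) s (pow s j) ⟩
      rhsCoef (suc N) (suc j) * (s * pow s j) + lowering (suc p) * (rhsCoef (suc N) j * pow s j) + s * (rhsCoef N j * pow s j)
        ≈⟨ +-cong (+-cong (lucRHS-even p (suc j) (≡.trans (≡.cong suc N≡) (≡.sym (k+[1+j+1+j]≡2+k+2j p j))))
                          (*-congˡ (lucRHS-even (suc (suc p)) j (≡.cong suc N≡))))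
                  (*-congˡ (lucRHS-even (suc p) j N≡)) ⟨
      stepCoef N (suc p) ∎
      where
      2+N≡ : suc (suc N) ≡ suc p ℕ.+ (suc j ℕ.+ suc j)
      2+N≡ = ≡.trans (≡.cong (suc ∘ suc) N≡) (≡.sym (k+[1+j+1+j]≡2+k+2j (suc p) j))

    lucRHS-rec : ∀ N → 1 ≤ N → suc (suc N) ≤ n₀ → ∀ k →
      lucRHS q s (suc (suc N)) k ≈ Aop q s (lucRHS q s (suc N)) k + s * lucRHS q s N k
    lucRHS-rec N 1≤N 2+N≤n₀ k = trans (by-gap k (gap (suc (suc N)) k)) (+-congʳ (sym (Aop-lowering (R (suc N)) k)))
      where
      R = lucRHS q s
      1+N≤n₀ = ℕ.≤-trans (ℕ.n≤1+n _) 2+N≤n₀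

      mulX-odd : ∀ k J → suc (suc N) ≡ k ℕ.+ suc (J ℕ.+ J) → mulX (R (suc N)) k ≈ 0#
      mulX-odd zero    J _   = refl
      mulX-odd (suc k) J 2+N≡ = lucRHS-odd k J (ℕ.suc-injective 2+N≡)

      by-gap : ∀ k → Gap (suc (suc N)) k → R (suc (suc N)) k ≈ stepCoef N k
      by-gap zero    (below ())
      by-gap (suc k) (below 2+N<1+k) = trans (lucRHS-below 2+N<1+k) (sym (≈0⇒x+a*y+b*z≈0 _ s
        (lucRHS-below 1+N<k) (lucRHS-below (ℕ.m<n⇒m<1+n (ℕ.m<n⇒m<1+n 1+N<k)))
        (lucRHS-below (ℕ.<-trans (ℕ.n<1+n N) (ℕ.m<n⇒m<1+n 1+N<k)))))
        where 1+N<k = ℕ.≤-pred 2+N<1+k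
      by-gap k (even zero 2+N≡k+0) with ≡.trans 2+N≡k+0 (ℕ.+-identityʳ k)
      ... | ≡.refl = begin
        R (suc (suc N)) (suc (suc N))    ≈⟨ lucRHS-top (suc (suc N)) (s≤s z≤n) 2+N≤n₀ ⟩
        1#                               ≈⟨ lucRHS-top (suc N) (s≤s z≤n) 1+N≤n₀ ⟨
        R (suc N) (suc N)                ≈⟨ trans (+-identityʳ _) (+-identityʳ _) ⟨
        R (suc N) (suc N) + 0# + 0#      ≈⟨ +-cong (+-congˡ (trans (*-congˡ below₁) (zeroʳ _))) (trans (*-congˡ below₂) (zeroʳ s)) ⟨
        stepCoef N (suc (suc N))         ∎
        where
        below₁ = lucRHS-below (ℕ.<-trans (ℕ.n<1+n (suc N)) (ℕ.n<1+n (suc (suc N))))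
        below₂ = lucRHS-below (ℕ.<-trans (ℕ.n<1+n N) (ℕ.n<1+n (suc N)))
      by-gap zero (even (suc zero) 2+N≡2) = ⊥-elim (ℕ.<⇒≢ 1≤N (≡.sym (ℕ.suc-injective (ℕ.suc-injective 2+N≡2))))
      by-gap zero (even (suc (suc j)) 2+N≡) = lucRHS-step-boundary j
        (ℕ.suc-injective (ℕ.suc-injective (≡.trans 2+N≡ (k+[1+j+1+j]≡2+k+2j 0 (suc j))))) 2+N≤n₀
      by-gap (suc p) (even (suc j) 2+N≡) = lucRHS-step-interior p j
        (ℕ.suc-injective (ℕ.suc-injective (≡.trans 2+N≡ (k+[1+j+1+j]≡2+k+2j (suc p) j)))) 2+N≤n₀
      by-gap k (odd zero 2+N≡) = trans (lucRHS-odd k 0 2+N≡) (sym (≈0⇒x+a*y+b*z≈0 _ s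
        (mulX-odd k 0 2+N≡) (lucRHS-below (s≤s (ℕ.≤-reflexive 1+N≡k))) (lucRHS-below (ℕ.≤-reflexive 1+N≡k))))
        where
        1+N≡k : suc N ≡ k
        1+N≡k = ℕ.suc-injective (≡.trans 2+N≡ (ℕ.+-comm k 1))
      by-gap k (odd (suc j) 2+N≡) = trans (lucRHS-odd k (suc j) 2+N≡) (sym (≈0⇒x+a*y+b*z≈0 _ s
        (mulX-odd k (suc j) 2+N≡) (lucRHS-odd (suc k) j (≡.cong suc N≡)) (lucRHS-odd k j N≡)))
        where
        N≡ : N ≡ k ℕ.+ suc (j ℕ.+ j)
        N≡ = ℕ.suc-injective (ℕ.suc-injective (≡.trans 2+N≡ (k+[1+1+j+1+j]≡2+k+1+2j k j)))

    lucRHS-1 : 1 ≤ n₀ → ∀ k → lucRHS q s 1 k ≈ mulX onePoly k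
    lucRHS-1 1≤n₀ zero          = lucRHS-odd 0 0 ≡.refl
    lucRHS-1 1≤n₀ (suc zero)    = lucRHS-top 1 (s≤s z≤n) 1≤n₀
    lucRHS-1 1≤n₀ (suc (suc k)) = lucRHS-below {1} {2 ℕ.+ k} (s≤s (s≤s z≤n))

    lucRHS-2 : 2 ≤ n₀ → ∀ k → lucRHS q s 2 k ≈ Aop q s (lucRHS q s 1) k + s * Luc q s 0 k
    lucRHS-2 2≤n₀ k = trans (by-k k) (+-congʳ (sym (Aop-lowering (R 1) k)))
      where
      R = lucRHS q s
      1≤n₀ = ℕ.≤-trans (s≤s z≤n) 2≤n₀
      by-k : ∀ k → R 2 k ≈ mulX (R 1) k + lowering k * R 1 (suc k) + s * ((1# + 1#) * onePoly k)
      by-k zero = begin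
        R 2 0                                      ≈⟨ lucRHS-even 0 1 ≡.refl ⟩
        rhsCoef 2 1 * (s * 1#)                     ≈⟨ *-congʳ (rhsCoef-2-1 2≤n₀) ⟩
        (1# + q) * (s * 1#)                        ≈⟨ solve 2 (λ q s → (con (+ 1) :+ q) :* (s :* con (+ 1))
                                                          := con (+ 0) :+ :- (s :* (con (+ 1) :- q :* con (+ 1))) :* con (+ 1)
                                                             :+ s :* ((con (+ 1) :+ con (+ 1)) :* con (+ 1))) refl q s ⟩
        0# + lowering 0 * 1# + s * ((1# + 1#) * 1#) ≈⟨ +-congʳ (+-congˡ (*-congˡ (lucRHS-top 1 (s≤s z≤n) 1≤n₀))) ⟨
        mulX (R 1) 0 + lowering 0 * R 1 1 + s * ((1# + 1#) * onePoly 0) ∎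
      by-k (suc zero) = trans (lucRHS-odd 1 0 ≡.refl) (sym (≈0⇒x+a*y+b*z≈0 (lowering 1) s
        (lucRHS-odd 0 0 ≡.refl) (lucRHS-below {1} {2} (s≤s (s≤s z≤n))) (zeroʳ _)))
      by-k (suc (suc zero)) = begin
        R 2 2                                      ≈⟨ lucRHS-top 2 (s≤s z≤n) 2≤n₀ ⟩
        1#                                         ≈⟨ lucRHS-top 1 (s≤s z≤n) 1≤n₀ ⟨
        R 1 1                                      ≈⟨ trans (+-congˡ (trans (*-congˡ (zeroʳ _)) (zeroʳ s))) (trans (+-identityʳ _) (+-identityʳ _)) ⟨
        R 1 1 + 0# + s * ((1# + 1#) * 0#)          ≈⟨ +-congʳ (+-congˡ (trans (*-congˡ (lucRHS-below {1} {3} (s≤s (s≤s z≤n)))) (zeroʳ _))) ⟨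
        mulX (R 1) 2 + lowering 2 * R 1 3 + s * ((1# + 1#) * onePoly 2) ∎
      by-k (suc (suc (suc k))) = trans (lucRHS-below {2} {3 ℕ.+ k} (s≤s (s≤s (s≤s z≤n)))) (sym (≈0⇒x+a*y+b*z≈0 (lowering (3 ℕ.+ k)) s
        (lucRHS-below {1} {2 ℕ.+ k} (s≤s (s≤s z≤n))) (lucRHS-below {1} {4 ℕ.+ k} (s≤s (s≤s z≤n))) (zeroʳ _)))

module Agreement {c ℓ} (F : Field c ℓ) (q s : Field.Carrier F) (q≉1 : ¬ (Field._≈_ F q (Field.1# F)))
                 (n₀ : ℕ) (q^k≉1 : ∀ k → 1 ≤ k → k ≤ n₀ → ¬ (Field._≈_ F (FieldDefs.pow F q k) (Field.1# F))) where
  open Field F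
  open FieldDefs F
  open LeftHandSide F q s
  open RightHandSide F q s
  open Nondegenerate q≉1 n₀ q^k≉1
  open import Data.Product.Base using (_×_; _,_; proj₁; proj₂)
  open import Relation.Binary.Reasoning.Setoid setoid

  Luc≈lucRHS-1 : 1 ≤ n₀ → ∀ k → Luc q s 1 k ≈ lucRHS q s 1 k
  Luc≈lucRHS-1 1≤n₀ k = trans (Luc-1 k) (trans (Aop-onePoly k) (sym (lucRHS-1 1≤n₀ k)))

  Luc≈lucRHS-consecutive : ∀ m → suc (suc m) ≤ n₀ →
    (∀ k → Luc q s (suc m) k ≈ lucRHS q s (suc m) k) × (∀ k → Luc q s (suc (suc m)) k ≈ lucRHS q s (suc (suc m)) k)
  Luc≈lucRHS-consecutive zero 2≤n₀ = Luc≈lucRHS-1 1≤n₀ , λ k → begin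
    Luc q s 2 k                                       ≈⟨ Luc-2 k ⟩
    Aop q s (Luc q s 1) k + s * Luc q s 0 k           ≈⟨ +-congʳ (Aop-cong (Luc≈lucRHS-1 1≤n₀) k) ⟩
    Aop q s (lucRHS q s 1) k + s * Luc q s 0 k        ≈⟨ lucRHS-2 2≤n₀ k ⟨
    lucRHS q s 2 k                                    ∎
    where 1≤n₀ = ℕ.≤-trans (s≤s z≤n) 2≤n₀
  Luc≈lucRHS-consecutive (suc m) 3+m≤n₀ = Luc≈lucRHS-2+m , λ k → begin
    Luc q s (3 ℕ.+ m) k                                            ≈⟨ Luc-rec (suc m) (s≤s z≤n) k ⟩
    Aop q s (Luc q s (2 ℕ.+ m)) k + s * Luc q s (suc m) k          ≈⟨ +-cong (Aop-cong Luc≈lucRHS-2+m k) (*-congˡ (Luc≈lucRHS-1+m k)) ⟩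
    Aop q s (lucRHS q s (2 ℕ.+ m)) k + s * lucRHS q s (suc m) k    ≈⟨ lucRHS-rec (suc m) (s≤s z≤n) 3+m≤n₀ k ⟨
    lucRHS q s (3 ℕ.+ m) k                                         ∎
    where
    ih = Luc≈lucRHS-consecutive m (ℕ.≤-trans (ℕ.n≤1+n _) 3+m≤n₀)
    Luc≈lucRHS-1+m = proj₁ ih
    Luc≈lucRHS-2+m = proj₂ ih

  Luc≈lucRHS : ∀ n → 1 ≤ n → n ≤ n₀ → ∀ k → Luc q s n k ≈ lucRHS q s n k
  Luc≈lucRHS (suc zero)    _ 1≤n₀  = Luc≈lucRHS-1 1≤n₀
  Luc≈lucRHS (suc (suc m)) _ 2+m≤n₀ = proj₂ (Luc≈lucRHS-consecutive m 2+m≤n₀)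

mainTheorem12 : ∀ {c ℓ} (F : Field c ℓ) →
    (q s : Field.Carrier F) → ¬ (Field._≈_ F q (Field.1# F)) →
    (n : ℕ) → 1 ≤ n →
    (∀ k → 1 ≤ k → k ≤ n → ¬ (Field._≈_ F (FieldDefs.pow F q k) (Field.1# F))) →
    ∀ k → Field._≈_ F (FieldDefs.Luc F q s n k) (FieldDefs.lucRHS F q s n k)
mainTheorem12 F q s q≉1 n 1≤n q^k≉1 = Agreement.Luc≈lucRHS F q s q≉1 n q^k≉1 n 1≤n ℕ.≤-refl
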